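{- Let $G=(V=L\cup R,E)$ be a bipartite graph and $W:E\to\mathbb{Z}$ edge weights that isolate a size-$k$ matching $M^k_{\mathrm{unique}}$ in $G$. Let $M^{k+1}$ be any minimum-weight matching of size $k+1$ in $G$. Then the symmetric difference $M^k_{\mathrm{unique}}\,\Delta\, M^{k+1}$ is a single augmenting path with respect to $M^k_{\mathrm{unique}}$.
   Context: A matching is a set of edges no two sharing an endpoint; a vertex is matched by $M$ if it is incident to an edge of $M$. $W(S)=\sum_{e\in S}W(e)$. $W$ isolates a size-$k$ matching $M^k_{\mathrm{unique}}$ if it is the unique minimum-weight matching among all matchings of size $k$. $M_1\Delta M_2=(M_1\setminus M_2)\cup(M_2\setminus M_1)$. A path with edges $e_1,\dots,e_m$ on vertices $v_1,\dots,v_{m+1}$ is an augmenting path with respect to $M$ if $v_1$ and $v_{m+1}$ are unmatched by $M$, $e_i\notin M$ for odd $i$, and $e_i\in M$ for even $i$. -}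

module Defs where

open import Data.Nat using (ℕ; zero; suc)
open import Data.Integer using (ℤ; 0ℤ; _≤_) renaming (_+_ to _+ℤ_)
open import Data.Fin using (Fin; zero; suc; toℕ; inject₁; fromℕ)
open import Data.Bool using (Bool; true; false; if_then_else_; _xor_; not)
open import Relation.Nullary using (¬_)
open import Data.Sum using (_⊎_; inj₁; inj₂)
open import Data.Product using (_×_; ∃; ∃-syntax; Σ)
open import Relation.Binary.PropositionalEquality using (_≡_)
open import Function.Definitions using (Injective)
open import Function.Bundles using (_⇔_)

sumℕ : (n : ℕ) → (Fin n → ℕ) → ℕ
sumℕ zero    f = 0
sumℕ (suc n) f = f zero Data.Nat.+ sumℕ n (λ i → f (suc i))

sumℤ : (n : ℕ) → (Fin n → ℤ) → ℤ
sumℤ zero    f = 0ℤ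
sumℤ (suc n) f = f zero +ℤ sumℤ n (λ i → f (suc i))

-- A finite bipartite graph with parts L = Fin nL and R = Fin nR.
-- Its edge set E is a subset of L × R (a simple bipartite graph).
EdgeSet : ℕ → ℕ → Set
EdgeSet nL nR = Fin nL → Fin nR → Bool

EdgeSubset : ℕ → ℕ → Set
EdgeSubset = EdgeSet

-- Integer edge weights W : E → ℤ (values on non-edges are never used).
Weights : ℕ → ℕ → Set
Weights nL nR = Fin nL → Fin nR → ℤ

Vtx : ℕ → ℕ → Set
Vtx nL nR = Fin nL ⊎ Fin nR

module _ {nL nR : ℕ} where

  record IsMatching (E : EdgeSet nL nR) (M : EdgeSubset nL nR) : Set where
    field
      sub      : ∀ a b → M a b ≡ true → E a b ≡ true
      uniqueR  : ∀ a b b′ → M a b ≡ true → M a b′ ≡ true → b ≡ b′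
      uniqueL  : ∀ a a′ b → M a b ≡ true → M a′ b ≡ true → a ≡ a′

  size : EdgeSubset nL nR → ℕ
  size M = sumℕ nL (λ a → sumℕ nR (λ b → if M a b then 1 else 0))

  weight : Weights nL nR → EdgeSubset nL nR → ℤ
  weight W M = sumℤ nL (λ a → sumℤ nR (λ b → if M a b then W a b else 0ℤ))

  SameSet : EdgeSubset nL nR → EdgeSubset nL nR → Set
  SameSet M N = ∀ a b → M a b ≡ N a b

  symDiff : EdgeSubset nL nR → EdgeSubset nL nR → EdgeSubset nL nR
  symDiff M N a b = M a b xor N a b

  record Isolates (E : EdgeSet nL nR) (W : Weights nL nR) (k : ℕ)
                  (M : EdgeSubset nL nR) : Set where
    field
      matching : IsMatching E M
      hasSize  : size M ≡ k
      minimal  : ∀ N → IsMatching E N → size N ≡ k → weight W M ≤ weight W N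
      unique   : ∀ N → IsMatching E N → size N ≡ k → weight W N ≡ weight W M
                 → SameSet N M

  record MinWeightMatching (E : EdgeSet nL nR) (W : Weights nL nR) (k : ℕ)
                           (M : EdgeSubset nL nR) : Set where
    field
      matching : IsMatching E M
      hasSize  : size M ≡ k
      minimal  : ∀ N → IsMatching E N → size N ≡ k → weight W M ≤ weight W N

  Matched : EdgeSubset nL nR → Vtx nL nR → Set
  Matched M (inj₁ a) = ∃[ b ] M a b ≡ true
  Matched M (inj₂ b) = ∃[ a ] M a b ≡ true

  Joins : Vtx nL nR → Vtx nL nR → Fin nL → Fin nR → Set
  Joins x y a b = (x ≡ inj₁ a × y ≡ inj₂ b) ⊎ (x ≡ inj₂ b × y ≡ inj₁ a)

  -- A path in G with m edges e₁,…,e_m on distinct vertices v₁,…,v_{m+1}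
  -- (here indexed from 0: vertices v 0,…,v m, edge i joins v i and v (i+1)).
  record Path (E : EdgeSet nL nR) : Set where
    field
      m        : ℕ
      v        : Fin (suc m) → Vtx nL nR
      distinct : Injective _≡_ _≡_ v
      step     : ∀ (i : Fin m) → ∃[ a ] ∃[ b ]
                   (Joins (v (inject₁ i)) (v (suc i)) a b × E a b ≡ true)

  open Path

  OnPath : {E : EdgeSet nL nR} → Path E → Fin nL → Fin nR → Set
  OnPath P a b = ∃[ i ] Joins (v P (inject₁ i)) (v P (suc i)) a b

  odd : ℕ → Bool
  odd zero    = false
  odd (suc n) = not (odd n)

  -- P is augmenting w.r.t. M: both end vertices unmatched by M; the
  -- 1-indexed edge e_j is not in M for odd j and is in M for even j
  -- (0-indexed edge i is in M iff i is odd).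
  record Augmenting {E : EdgeSet nL nR} (M : EdgeSubset nL nR) (P : Path E) : Set where
    field
      startFree : ¬ Matched M (v P zero)
      endFree   : ¬ Matched M (v P (fromℕ (m P)))
      alternate : ∀ (i : Fin (m P)) a b →
                  Joins (v P (inject₁ i)) (v P (suc i)) a b → M a b ≡ odd (toℕ i)

  IsAugmentingPath : (E : EdgeSet nL nR) → EdgeSubset nL nR → EdgeSubset nL nR → Set
  IsAugmentingPath E M S =
    Σ (Path E) λ P → Augmenting M P × (∀ a b → (S a b ≡ true) ⇔ OnPath P a b)

{-# OPTIONS --safe #-}
module Submission where

-- Write M = Mk and N = Mk1. Since |N| > |M| some L-vertex a₀ is covered by N but not by M.
-- Walk from a₀, leaving L-vertices along N-edges and R-vertices along M-edges. Because M and N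
-- are matchings this step is a partial injection of the finite vertex set with a₀ outside its
-- image, so the walk is a simple path P that eventually stops. Exchanging the rows of M and N at
-- the L-vertices of P yields matchings M Δ P and N Δ P whose sizes and weights add up to those of
-- M and N. If P ended in L, M Δ P would have size k and, N being of minimum weight, weight at most
-- W(M), so it would equal M by isolation, which fails at a₀. Hence P ends in R; now N Δ P has
-- size k and weight at most W(M), so N Δ P = M, i.e. M and N agree off P and M Δ N is exactly P.

open import Defs
open import Data.Nat using (ℕ; suc; zero; _+_; _≤_; _<_; z≤n; s≤s; _<?_)
open import Data.Nat.Properties
  using ( +-comm; +-suc; +-identityʳ; +-cancelˡ-≡; +-mono-≤; ≤-pred; <⇒≤; <-irrefl; ≤⇒≯; ≮⇒≥
        ; n<1+n        ; m≤n⇒m<n∨m≡n; m≢1+n+m; anyUpTo? )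
import Data.Nat.Properties as ℕₚ
open import Data.Integer using (ℤ; 0ℤ) renaming (_+_ to _+ℤ_; _≤_ to _≤ℤ_)
import Data.Integer.Properties as ℤₚ
open import Algebra.Properties.CommutativeSemigroup ℕₚ.+-commutativeSemigroup
  using () renaming (interchange to ℕ-+-interchange)
open import Algebra.Properties.CommutativeSemigroup ℤₚ.+-commutativeSemigroup
  using () renaming (interchange to ℤ-+-interchange)
open import Data.Fin using (Fin; zero; suc; toℕ; inject₁; fromℕ<)
open import Data.Fin.Properties
  using ( any?; pigeonhole; toℕ-injective; toℕ<n; toℕ≤pred[n]; toℕ-inject₁; toℕ-fromℕ; toℕ-fromℕ<
        ; +↔⊎ )
  renaming (_≟_ to _≟ᶠ_)
open import Data.Bool using (Bool; true; false; if_then_else_; _xor_; not)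
open import Data.Bool.Properties using (xor-same; xor-identityʳ; ¬-not; not-¬) renaming (_≟_ to _≟ᵇ_)
open import Data.Sum using (_⊎_; inj₁; inj₂)
open import Data.Sum.Properties using (≡-dec; inj₁-injective)
open import Data.Product using (_×_; _,_; ∃; ∃-syntax; proj₁; proj₂; map₁)
open import Data.Maybe using (Maybe; just; nothing; fromMaybe)
open import Data.Maybe.Properties using (just-injective)
open import Data.Empty using (⊥)
open import Function using (_∘_; _↣_; Injection; _⇔_; mk⇔)
open import Function.Definitions using (Injective)
open import Function.Properties.Inverse using (↔⇒↣; ↔-sym)
open import Relation.Nullary using (¬_; Dec; yes; no; does; contradiction)
open import Relation.Nullary.Decidable using (dec-true; dec-false)
open import Relation.Unary using (Decidable)
open import Relation.Binary.PropositionalEquality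

sumℕ-cong : ∀ n {f g : Fin n → ℕ} → f ≗ g → sumℕ n f ≡ sumℕ n g
sumℕ-cong zero    f≗g = refl
sumℕ-cong (suc n) f≗g = cong₂ _+_ (f≗g zero) (sumℕ-cong n (f≗g ∘ suc))

sumℤ-cong : ∀ n {f g : Fin n → ℤ} → f ≗ g → sumℤ n f ≡ sumℤ n g
sumℤ-cong zero    f≗g = refl
sumℤ-cong (suc n) f≗g = cong₂ _+ℤ_ (f≗g zero) (sumℤ-cong n (f≗g ∘ suc))

sumℕ-distrib-+ : ∀ n (f g : Fin n → ℕ) → sumℕ n (λ i → f i + g i) ≡ sumℕ n f + sumℕ n g
sumℕ-distrib-+ zero    f g = refl
sumℕ-distrib-+ (suc n) f g =
  trans (cong ((f zero + g zero) +_) (sumℕ-distrib-+ n (f ∘ suc) (g ∘ suc)))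
        (ℕ-+-interchange (f zero) (g zero) _ _)

sumℤ-distrib-+ : ∀ n (f g : Fin n → ℤ) → sumℤ n (λ i → f i +ℤ g i) ≡ sumℤ n f +ℤ sumℤ n g
sumℤ-distrib-+ zero    f g = refl
sumℤ-distrib-+ (suc n) f g =
  trans (cong ((f zero +ℤ g zero) +ℤ_) (sumℤ-distrib-+ n (f ∘ suc) (g ∘ suc)))
        (ℤ-+-interchange (f zero) (g zero) _ _)

sumℕ-zero : ∀ n → sumℕ n (λ _ → 0) ≡ 0
sumℕ-zero zero    = refl
sumℕ-zero (suc n) = sumℕ-zero n

sumℕ-mono-≤ : ∀ n {f g : Fin n → ℕ} → (∀ i → f i ≤ g i) → sumℕ n f ≤ sumℕ n g
sumℕ-mono-≤ zero    f≤g = z≤n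
sumℕ-mono-≤ (suc n) f≤g = +-mono-≤ (f≤g zero) (sumℕ-mono-≤ n (f≤g ∘ suc))

sumℕ-<⇒∃< : ∀ n {f g : Fin n → ℕ} → sumℕ n f < sumℕ n g → ∃ λ i → f i < g i
sumℕ-<⇒∃< n {f} {g} lt with any? (λ i → f i <? g i)
... | yes found = found
... | no none   = contradiction lt (≤⇒≯ (sumℕ-mono-≤ n (λ i → ≮⇒≥ (none ∘ (i ,_)))))

δ : ∀ {n} → Fin n → Fin n → ℕ
δ zero    zero    = 1
δ zero    (suc _) = 0
δ (suc _) zero    = 0
δ (suc j) (suc i) = δ j i

δ-diag : ∀ {n} (j : Fin n) → δ j j ≡ 1
δ-diag zero    = refl
δ-diag (suc j) = δ-diag j

δ-off : ∀ {n} {i j : Fin n} → i ≢ j → δ j i ≡ 0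
δ-off {i = zero}  {zero}  i≢j = contradiction refl i≢j
δ-off {i = zero}  {suc j} _   = refl
δ-off {i = suc i} {zero}  _   = refl
δ-off {i = suc i} {suc j} i≢j = δ-off (i≢j ∘ cong suc)

sumℕ-δ : ∀ n (j : Fin n) → sumℕ n (δ j) ≡ 1
sumℕ-δ (suc n) zero    = cong suc (sumℕ-zero n)
sumℕ-δ (suc n) (suc j) = sumℕ-δ n j

sumℕ-+δ : ∀ n {f g : Fin n → ℕ} (j : Fin n) → (∀ i → f i ≡ g i + δ j i) →
          sumℕ n f ≡ suc (sumℕ n g)
sumℕ-+δ n {f} {g} j f≗g+δ = begin
  sumℕ n f                        ≡⟨ sumℕ-cong n f≗g+δ ⟩
  sumℕ n (λ i → g i + δ j i)     ≡⟨ sumℕ-distrib-+ n g (δ j) ⟩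
  sumℕ n g + sumℕ n (δ j)         ≡⟨ cong (sumℕ n g +_) (sumℕ-δ n j) ⟩
  sumℕ n g + 1                    ≡⟨ +-comm (sumℕ n g) 1 ⟩
  suc (sumℕ n g)                  ∎
  where open ≡-Reasoning

sumℕ-δ-cancel : ∀ n {f g : Fin n → ℕ} (j j′ : Fin n) → (∀ i → f i + δ j i ≡ g i + δ j′ i) →
                sumℕ n f ≡ sumℕ n g
sumℕ-δ-cancel n {f} {g} j j′ eq = ℕₚ.suc-injective (begin
  suc (sumℕ n f)               ≡⟨ sumℕ-+δ n j (λ _ → refl) ⟨
  sumℕ n (λ i → f i + δ j i)   ≡⟨ sumℕ-cong n eq ⟩
  sumℕ n (λ i → g i + δ j′ i)  ≡⟨ sumℕ-+δ n j′ (λ _ → refl) ⟩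
  suc (sumℕ n g)               ∎)
  where open ≡-Reasoning

+≡+⇒≡ˡ : ∀ {a b c d} → a +ℤ b ≡ c +ℤ d → c ≤ℤ a → d ≤ℤ b → a ≡ c
+≡+⇒≡ˡ eq c≤a d≤b =
  ℤₚ.≤-antisym (ℤₚ.≮⇒≥ λ c<a → ℤₚ.<-irrefl (sym eq) (ℤₚ.+-mono-<-≤ c<a d≤b)) c≤a

module _ {nL nR : ℕ} where

  degree : EdgeSubset nL nR → Fin nL → ℕ
  degree M a = sumℕ nR (λ b → if M a b then 1 else 0)

  rowWeight : Weights nL nR → EdgeSubset nL nR → Fin nL → ℤ
  rowWeight W M a = sumℤ nR (λ b → if M a b then W a b else 0ℤ)

  degree-free : ∀ {M : EdgeSubset nL nR} {a} → (∀ b → M a b ≡ false) → degree M a ≡ 0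
  degree-free free = trans (sumℕ-cong nR (cong (λ c → if c then 1 else 0) ∘ free)) (sumℕ-zero nR)

  degree-matched : ∀ {E M : EdgeSubset nL nR} {a b} → IsMatching E M → M a b ≡ true → degree M a ≡ 1
  degree-matched {M = M} {a} {b} M-matching Mab = trans (sumℕ-cong nR indicator≗δ) (sumℕ-δ nR b)
    where
    indicator≗δ : ∀ b′ → (if M a b′ then 1 else 0) ≡ δ b b′
    indicator≗δ b′ with M a b′ in Mab′
    ... | true  = trans (sym (δ-diag b)) (cong (δ b) (IsMatching.uniqueR M-matching a b b′ Mab Mab′))
    ... | false = sym (δ-off λ b′≡b → not-¬ Mab (subst (λ x → M a x ≡ false) b′≡b Mab′))

  size<⇒free-vertex : ∀ {E M N : EdgeSubset nL nR} → IsMatching E M → IsMatching E N → size M < size N →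
                      ∃ λ a → (∀ b → M a b ≡ false) × ∃ λ b → N a b ≡ true
  size<⇒free-vertex {M = M} {N} M-matching N-matching |M|<|N| with sumℕ-<⇒∃< nL |M|<|N|
  ... | a , dM<dN with any? (λ b → N a b ≟ᵇ true)
  ...   | no N-free     = contradiction (subst (degree M a <_) (degree-free {M = N} N-free′) dM<dN) ℕₚ.n≮0
    where
    N-free′ : ∀ b → N a b ≡ false
    N-free′ b = ¬-not λ Nab → N-free (b , Nab)
  ...   | yes (b , Nab) = a , M-free , b , Nab
    where
    M-free : ∀ b′ → M a b′ ≡ false
    M-free b′ = ¬-not λ Mab′ →
      <-irrefl (trans (degree-matched M-matching Mab′) (sym (degree-matched N-matching Nab))) dM<dN

  swapOn : {S : Fin nL → Set} → Decidable S → EdgeSubset nL nR → EdgeSubset nL nR → EdgeSubset nL nR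
  swapOn S? M N a = if does (S? a) then N a else M a

  swapOn-in : ∀ {S} (S? : Decidable S) (M N : EdgeSubset nL nR) {a} → S a → swapOn S? M N a ≡ N a
  swapOn-in S? M N {a} s = cong (λ c → if c then N a else M a) (dec-true (S? a) s)

  swapOn-out : ∀ {S} (S? : Decidable S) (M N : EdgeSubset nL nR) {a} → ¬ S a → swapOn S? M N a ≡ M a
  swapOn-out S? M N {a} ¬s = cong (λ c → if c then N a else M a) (dec-false (S? a) ¬s)

  ClosedAlong : (Fin nL → Set) → EdgeSubset nL nR → EdgeSubset nL nR → Set
  ClosedAlong S N M = ∀ {a a′ b} → S a → N a b ≡ true → M a′ b ≡ true → S a′

  swapOn-isMatching : ∀ {E M N : EdgeSubset nL nR} {S} (S? : Decidable S) →
                      IsMatching E M → IsMatching E N → ClosedAlong S N M → IsMatching E (swapOn S? M N)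
  swapOn-isMatching {E} {M} {N} S? M-matching N-matching closed =
    record { sub = sub ; uniqueR = uniqueR ; uniqueL = uniqueL }
    where
    module M = IsMatching M-matching
    module N = IsMatching N-matching
    X : EdgeSubset nL nR
    X = swapOn S? M N
    sub : ∀ a b → X a b ≡ true → E a b ≡ true
    sub a with S? a
    ... | yes _ = N.sub a
    ... | no _  = M.sub a
    uniqueR : ∀ a b b′ → X a b ≡ true → X a b′ ≡ true → b ≡ b′
    uniqueR a with S? a
    ... | yes _ = N.uniqueR a
    ... | no _  = M.uniqueR a
    uniqueL : ∀ a a′ b → X a b ≡ true → X a′ b ≡ true → a ≡ a′
    uniqueL a a′ b with S? a | S? a′
    ... | yes _  | yes _   = N.uniqueL a a′ b
    ... | no _   | no _    = M.uniqueL a a′ b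
    ... | yes s  | no ¬s′  = λ p q → contradiction (closed s p q) ¬s′
    ... | no ¬s  | yes s′  = λ p q → contradiction (closed s′ q p) ¬s

  size-swapOn : ∀ {S} (S? : Decidable S) (M N : EdgeSubset nL nR) →
                size (swapOn S? M N) + size (swapOn S? N M) ≡ size M + size N
  size-swapOn S? M N = begin
    size (swapOn S? M N) + size (swapOn S? N M)                          ≡⟨ sumℕ-distrib-+ nL _ _ ⟨
    sumℕ nL (λ a → degree (swapOn S? M N) a + degree (swapOn S? N M) a) ≡⟨ sumℕ-cong nL row ⟩
    sumℕ nL (λ a → degree M a + degree N a)                              ≡⟨ sumℕ-distrib-+ nL _ _ ⟩
    size M + size N                                                      ∎
    where
    open ≡-Reasoning
    row : ∀ a → degree (swapOn S? M N) a + degree (swapOn S? N M) a ≡ degree M a + degree N a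
    row a with S? a
    ... | yes _ = +-comm (degree N a) (degree M a)
    ... | no _  = refl

  weight-swapOn : ∀ {S} (S? : Decidable S) (W : Weights nL nR) (M N : EdgeSubset nL nR) →
                  weight W (swapOn S? M N) +ℤ weight W (swapOn S? N M) ≡ weight W M +ℤ weight W N
  weight-swapOn S? W M N = begin
    weight W (swapOn S? M N) +ℤ weight W (swapOn S? N M)
      ≡⟨ sumℤ-distrib-+ nL _ _ ⟨
    sumℤ nL (λ a → rowWeight W (swapOn S? M N) a +ℤ rowWeight W (swapOn S? N M) a)
      ≡⟨ sumℤ-cong nL row ⟩
    sumℤ nL (λ a → rowWeight W M a +ℤ rowWeight W N a)
      ≡⟨ sumℤ-distrib-+ nL _ _ ⟩
    weight W M +ℤ weight W N
      ∎
    where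
    open ≡-Reasoning
    row : ∀ a → rowWeight W (swapOn S? M N) a +ℤ rowWeight W (swapOn S? N M) a
              ≡ rowWeight W M a +ℤ rowWeight W N a
    row a with S? a
    ... | yes _ = ℤₚ.+-comm (rowWeight W N a) (rowWeight W M a)
    ... | no _  = refl

  isolated-exchange : ∀ {E : EdgeSet nL nR} {W k l} {M N X Y : EdgeSubset nL nR} →
                      Isolates E W k M → MinWeightMatching E W l N →
                      IsMatching E X → IsMatching E Y → size X ≡ k → size Y ≡ l →
                      weight W X +ℤ weight W Y ≡ weight W M +ℤ weight W N → SameSet X M
  isolated-exchange {X = X} {Y} iso min X-matching Y-matching |X| |Y| weights =
    Isolates.unique iso X X-matching |X|
      (+≡+⇒≡ˡ weights (Isolates.minimal iso X X-matching |X|) (MinWeightMatching.minimal min Y Y-matching |Y|))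

module PartialInjection {A : Set} (σ : A → Maybe A)
                        (σ-injective : ∀ {x y z} → σ x ≡ just z → σ y ≡ just z → x ≡ y)
                        (x₀ : A) (x₀-initial : ∀ x → σ x ≢ just x₀) where

  orbit : ℕ → A
  orbit zero    = x₀
  orbit (suc i) = fromMaybe (orbit i) (σ (orbit i))

  Advances : ℕ → Set
  Advances n = ∀ {i} → i < n → σ (orbit i) ≡ just (orbit (suc i))

  just⇒advances : ∀ {i y} → σ (orbit i) ≡ just y → σ (orbit i) ≡ just (orbit (suc i))
  just⇒advances eq rewrite eq = refl

  advances⇒orbit-injective : ∀ {n i j} → Advances n → i ≤ n → j ≤ n → orbit i ≡ orbit j → i ≡ j
  advances⇒orbit-injective {i = zero}  {zero}  adv _   _   _  = refl
  advances⇒orbit-injective {i = zero}  {suc j} adv _   j<n eq =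
    contradiction (trans (adv j<n) (cong just (sym eq))) (x₀-initial _)
  advances⇒orbit-injective {i = suc i} {zero}  adv i<n _   eq =
    contradiction (trans (adv i<n) (cong just eq)) (x₀-initial _)
  advances⇒orbit-injective {i = suc i} {suc j} adv i<n j<n eq =
    cong suc (advances⇒orbit-injective adv (<⇒≤ i<n) (<⇒≤ j<n)
                (σ-injective (trans (adv i<n) (cong just eq)) (adv j<n)))

  record Terminates : Set where
    field
      steps    : ℕ
      advances : Advances steps
      halts    : σ (orbit steps) ≡ nothing

    orbit-injective : ∀ {i j} → i ≤ steps → j ≤ steps → orbit i ≡ orbit j → i ≡ j
    orbit-injective = advances⇒orbit-injective advances

    orbit-succ : ∀ {i y} → i ≤ steps → σ (orbit i) ≡ just y → i < steps × orbit (suc i) ≡ y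
    orbit-succ i≤steps eq with m≤n⇒m<n∨m≡n i≤steps
    ... | inj₁ i<steps = i<steps , just-injective (trans (sym (advances i<steps)) eq)
    ... | inj₂ refl    = contradiction (trans (sym halts) eq) λ ()

    orbit-pred : ∀ {i x} → i ≤ steps → σ x ≡ just (orbit i) → ∃ λ j → i ≡ suc j × x ≡ orbit j
    orbit-pred {zero}  _       eq = contradiction eq (x₀-initial _)
    orbit-pred {suc j} j<steps eq = j , refl , σ-injective eq (advances j<steps)

    orbit-no-backtrack : ∀ {i} → i < steps → σ (orbit (suc i)) ≢ just (orbit i)
    orbit-no-backtrack i<steps eq with orbit-pred (<⇒≤ i<steps) eq
    ... | j , refl , same = m≢1+n+m j (sym (orbit-injective i<steps (<⇒≤ (<⇒≤ i<steps)) same))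

  advances-or-terminates : ∀ n → Advances n ⊎ Terminates
  advances-or-terminates zero    = inj₁ λ ()
  advances-or-terminates (suc n) with advances-or-terminates n
  ... | inj₂ t   = inj₂ t
  ... | inj₁ adv with σ (orbit n) in eq
  ...   | nothing = inj₂ record { steps = n ; advances = adv ; halts = eq }
  ...   | just _  = inj₁ advances
    where
    advances : Advances (suc n)
    advances i<1+n with m≤n⇒m<n∨m≡n (≤-pred i<1+n)
    ... | inj₁ i<n  = adv i<n
    ... | inj₂ refl = just⇒advances {n} eq

  terminates : ∀ {n} → A ↣ Fin n → Terminates
  terminates {n} A↣Fin with advances-or-terminates n
  ... | inj₂ t   = t
  ... | inj₁ adv with pigeonhole (n<1+n n) (Injection.to A↣Fin ∘ orbit ∘ toℕ)
  ...   | i , j , i<j , same =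
    contradiction
      (advances⇒orbit-injective adv (toℕ≤pred[n] i) (toℕ≤pred[n] j) (Injection.injective A↣Fin same))
      (ℕₚ.<⇒≢ i<j)

module AlternatingWalk {nL nR : ℕ} {E : EdgeSet nL nR} {M N : EdgeSubset nL nR}
                       (M-matching : IsMatching E M) (N-matching : IsMatching E N)
                       (a₀ : Fin nL) (a₀-free : ∀ b → M a₀ b ≡ false) where

  private
    module M = IsMatching M-matching
    module N = IsMatching N-matching

  V : Set
  V = Vtx nL nR

  Step : V → V → Set
  Step (inj₁ a) (inj₂ b) = N a b ≡ true
  Step (inj₂ b) (inj₁ a) = M a b ≡ true
  Step (inj₁ _) (inj₁ _) = ⊥
  Step (inj₂ _) (inj₂ _) = ⊥

  Step-functional : ∀ {x y z} → Step x y → Step x z → y ≡ z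
  Step-functional {inj₁ a} {inj₂ b} {inj₂ b′} p q = cong inj₂ (N.uniqueR a b b′ p q)
  Step-functional {inj₂ b} {inj₁ a} {inj₁ a′} p q = cong inj₁ (M.uniqueL a a′ b p q)
  Step-functional {inj₁ _} {inj₁ _} ()
  Step-functional {inj₂ _} {inj₂ _} ()
  Step-functional {inj₁ _} {inj₂ _} {inj₁ _} _ ()
  Step-functional {inj₂ _} {inj₁ _} {inj₂ _} _ ()

  Step-injective : ∀ {x y z} → Step x z → Step y z → x ≡ y
  Step-injective {inj₁ a} {inj₁ a′} {inj₂ b} p q = cong inj₁ (N.uniqueL a a′ b p q)
  Step-injective {inj₂ b} {inj₂ b′} {inj₁ a} p q = cong inj₂ (M.uniqueR a b b′ p q)
  Step-injective {inj₁ _} {_}      {inj₁ _} ()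
  Step-injective {inj₂ _} {_}      {inj₂ _} ()
  Step-injective {inj₁ _} {inj₂ _} {inj₂ _} _ ()
  Step-injective {inj₂ _} {inj₁ _} {inj₁ _} _ ()

  Step-edge : ∀ {x y} → Step x y → ∃[ a ] ∃[ b ] (Joins x y a b × E a b ≡ true)
  Step-edge {inj₁ a} {inj₂ b} Nab = a , b , inj₁ (refl , refl) , N.sub a b Nab
  Step-edge {inj₂ b} {inj₁ a} Mab = a , b , inj₂ (refl , refl) , M.sub a b Mab

  Step-from-L : ∀ {a y} → Step (inj₁ a) y → ∃ λ b → N a b ≡ true
  Step-from-L {y = inj₂ b} Nab = b , Nab

  Step-into-L : ∀ {x a} → Step x (inj₁ a) → ∃ λ b → M a b ≡ true
  Step-into-L {inj₂ b} Mab = b , Mab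

  isRight : V → Bool
  isRight (inj₁ _) = false
  isRight (inj₂ _) = true

  Step-switches-side : ∀ {x y} → Step x y → isRight y ≡ not (isRight x)
  Step-switches-side {inj₁ _} {inj₂ _} _ = refl
  Step-switches-side {inj₂ _} {inj₁ _} _ = refl

  alternating-edge : ∀ {x y a b} → Step x y → ¬ Step y x → Joins x y a b →
                     M a b ≡ isRight x × M a b xor N a b ≡ true
  alternating-edge Nab ¬Mab (inj₁ (refl , refl)) = ¬-not ¬Mab , cong₂ _xor_ (¬-not ¬Mab) Nab
  alternating-edge Mab ¬Nab (inj₂ (refl , refl)) = Mab , cong₂ _xor_ Mab (¬-not ¬Nab)

  along : ∀ {m} {P : Fin m → Set} → (Fin m → V) → Dec (∃ P) → Maybe V
  along f (yes (i , _)) = just (f i)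
  along f (no _)        = nothing

  along-just : ∀ {m} {P : Fin m → Set} {f : Fin m → V} {y} (d : Dec (∃ P)) →
               along f d ≡ just y → ∃ λ i → P i × f i ≡ y
  along-just (yes (i , p)) refl = i , p , refl

  along-nothing : ∀ {m} {P : Fin m → Set} {f : Fin m → V} (d : Dec (∃ P)) →
                  along f d ≡ nothing → ¬ ∃ P
  along-nothing (no ¬p) _ = ¬p

  next : V → Maybe V
  next (inj₁ a) = along inj₂ (any? λ b → N a b ≟ᵇ true)
  next (inj₂ b) = along inj₁ (any? λ a → M a b ≟ᵇ true)

  next-sound : ∀ x {y} → next x ≡ just y → Step x y
  next-sound (inj₁ a) eq with along-just (any? λ b → N a b ≟ᵇ true) eq
  ... | _ , Nab , refl = Nab
  next-sound (inj₂ b) eq with along-just (any? λ a → M a b ≟ᵇ true) eq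
  ... | _ , Mab , refl = Mab

  next-nothing : ∀ x {y} → next x ≡ nothing → ¬ Step x y
  next-nothing (inj₁ a) {inj₂ b} eq Nab = along-nothing (any? λ b → N a b ≟ᵇ true) eq (b , Nab)
  next-nothing (inj₂ b) {inj₁ a} eq Mab = along-nothing (any? λ a → M a b ≟ᵇ true) eq (a , Mab)

  next-complete : ∀ {x y} → Step x y → next x ≡ just y
  next-complete {x} s with next x in eq
  ... | just _  = cong just (Step-functional (next-sound x eq) s)
  ... | nothing = contradiction s (next-nothing x eq)

  next-injective : ∀ {x y z} → next x ≡ just z → next y ≡ just z → x ≡ y
  next-injective {x} {y} p q = Step-injective (next-sound x p) (next-sound y q)

  next-initial : ∀ x → next x ≢ just (inj₁ a₀)
  next-initial (inj₂ b) eq = not-¬ (next-sound (inj₂ b) eq) (a₀-free b)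
  next-initial (inj₁ a) eq = next-sound (inj₁ a) eq

  open PartialInjection next next-injective (inj₁ a₀) next-initial public
  open Terminates (terminates (↔⇒↣ (↔-sym +↔⊎))) public

  walk-step : ∀ {i x y} → i < steps → orbit i ≡ x → orbit (suc i) ≡ y → Step x y
  walk-step i<steps refl refl = next-sound _ (advances i<steps)

  walk-succ : ∀ {i x y} → i ≤ steps → orbit i ≡ x → Step x y → i < steps × orbit (suc i) ≡ y
  walk-succ i≤steps refl s = orbit-succ i≤steps (next-complete s)

  walk-pred : ∀ {i x y} → i ≤ steps → orbit i ≡ y → Step x y → ∃ λ j → i ≡ suc j × orbit j ≡ x
  walk-pred i≤steps refl s with orbit-pred i≤steps (next-complete s)
  ... | j , i≡1+j , x≡orbit-j = j , i≡1+j , sym x≡orbit-j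

  walk-halts : ∀ {x y} → orbit steps ≡ x → ¬ Step x y
  walk-halts refl = next-nothing _ halts

  walk-parity : ∀ {i} → i ≤ steps → isRight (orbit i) ≡ odd {nL} {nR} i
  walk-parity {zero}  _       = refl
  walk-parity {suc i} i<steps =
    trans (Step-switches-side (walk-step i<steps refl refl)) (cong not (walk-parity (<⇒≤ i<steps)))

  OnWalk : Fin nL → Set
  OnWalk a = ∃ λ i → i < suc steps × orbit i ≡ inj₁ a

  onWalk? : Decidable OnWalk
  onWalk? a = anyUpTo? (λ i → ≡-dec _≟ᶠ_ _≟ᶠ_ (orbit i) (inj₁ a)) (suc steps)

  a₀-onWalk : OnWalk a₀
  a₀-onWalk = zero , s≤s z≤n , refl

  onWalk-closedAlong-N-M : ClosedAlong OnWalk N M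
  onWalk-closedAlong-N-M {b = b} (i , s≤s i≤steps , eq) Nab Ma′b
    with walk-succ {y = inj₂ b} i≤steps eq Nab
  ... | i<steps , e with walk-succ i<steps e Ma′b
  ... | i+1<steps , e′ = suc (suc i) , s≤s i+1<steps , e′

  onWalk-closedAlong-M-N : ClosedAlong OnWalk M N
  onWalk-closedAlong-M-N {a′ = a′} {b} (i , s≤s i≤steps , eq) Mab Na′b
    with walk-pred {x = inj₂ b} i≤steps eq Mab
  ... | j , refl , e with walk-pred {x = inj₁ a′} (<⇒≤ i≤steps) e Na′b
  ... | j′ , refl , e′ = j′ , ℕₚ.m≤n⇒m≤1+n (<⇒≤ i≤steps) , e′

  degree-M-onWalk : ∀ {a} → OnWalk a → degree M a + δ a₀ a ≡ 1
  degree-M-onWalk (zero , _ , refl) = trans (cong (_+ δ a₀ a₀) (degree-free {M = M} a₀-free)) (δ-diag a₀)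
  degree-M-onWalk {a} (suc i , s≤s i<steps , eq) with Step-into-L (walk-step i<steps refl eq)
  ... | b , Mab = cong₂ _+_ (degree-matched M-matching Mab) (δ-off a≢a₀)
    where
    a≢a₀ : a ≢ a₀
    a≢a₀ refl = not-¬ Mab (a₀-free b)

  degree-N-onWalk : ∀ {a} → OnWalk a → orbit steps ≢ inj₁ a → degree N a ≡ 1
  degree-N-onWalk (i , s≤s i≤steps , eq) not-last with m≤n⇒m<n∨m≡n i≤steps
  ... | inj₁ i<steps = degree-matched N-matching (proj₂ (Step-from-L (walk-step i<steps eq refl)))
  ... | inj₂ refl    = contradiction eq not-last

  degree-N-last : ∀ {a} → orbit steps ≡ inj₁ a → degree N a ≡ 0
  degree-N-last last = degree-free {M = N} λ b → ¬-not (walk-halts {y = inj₂ b} last)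

  δ-offWalk : ∀ {a a′} → ¬ OnWalk a → OnWalk a′ → δ a′ a ≡ 0
  δ-offWalk {a} {a′} ¬w w′ = δ-off {i = a} {a′} λ { refl → ¬w w′ }

  degree-N-onWalk+δ : ∀ {a aE} → orbit steps ≡ inj₁ aE → OnWalk a → degree N a + δ aE a ≡ 1
  degree-N-onWalk+δ {a} {aE} last w with a ≟ᶠ aE
  ... | yes refl = cong₂ _+_ (degree-N-last last) (δ-diag aE)
  ... | no a≢aE  =
    cong₂ _+_ (degree-N-onWalk w λ e → a≢aE (inj₁-injective (trans (sym e) last))) (δ-off a≢aE)

  -- M Δ P and N Δ P for the walk P: at each L-vertex of P the rows of M and N are exchanged.
  M△P N△P : EdgeSubset nL nR
  M△P = swapOn onWalk? M N
  N△P = swapOn onWalk? N M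

  M△P-isMatching : IsMatching E M△P
  M△P-isMatching = swapOn-isMatching onWalk? M-matching N-matching onWalk-closedAlong-N-M

  N△P-isMatching : IsMatching E N△P
  N△P-isMatching = swapOn-isMatching onWalk? N-matching M-matching onWalk-closedAlong-M-N

  size-M△P-endˡ : ∀ {aE} → orbit steps ≡ inj₁ aE → size M△P ≡ size M
  size-M△P-endˡ {aE} last = sumℕ-δ-cancel nL aE a₀ row
    where
    aE-onWalk : OnWalk aE
    aE-onWalk = steps , n<1+n steps , last
    row : ∀ a → degree M△P a + δ aE a ≡ degree M a + δ a₀ a
    row a with onWalk? a
    ... | yes w  = trans (degree-N-onWalk+δ last w) (sym (degree-M-onWalk w))
    ... | no ¬w  = cong (degree M a +_) (trans (δ-offWalk ¬w aE-onWalk) (sym (δ-offWalk ¬w a₀-onWalk)))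

  size-M△P-endʳ : ∀ {bE} → orbit steps ≡ inj₂ bE → size M△P ≡ suc (size M)
  size-M△P-endʳ last = sumℕ-+δ nL a₀ row
    where
    row : ∀ a → degree M△P a ≡ degree M a + δ a₀ a
    row a with onWalk? a
    ... | yes w =
      trans (degree-N-onWalk w λ e → contradiction (trans (sym e) last) λ ()) (sym (degree-M-onWalk w))
    ... | no ¬w = sym (trans (cong (degree M a +_) (δ-offWalk ¬w a₀-onWalk)) (+-identityʳ (degree M a)))

  size-N△P-endˡ : ∀ {aE} → orbit steps ≡ inj₁ aE → size N△P ≡ size N
  size-N△P-endˡ last = +-cancelˡ-≡ (size M) _ _ (begin
    size M + size N△P    ≡⟨ cong (_+ size N△P) (size-M△P-endˡ last) ⟨
    size M△P + size N△P  ≡⟨ size-swapOn onWalk? M N ⟩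
    size M + size N      ∎)
    where open ≡-Reasoning

  size-N△P-endʳ : ∀ {bE} → orbit steps ≡ inj₂ bE → suc (size N△P) ≡ size N
  size-N△P-endʳ last = +-cancelˡ-≡ (size M) _ _ (begin
    size M + suc (size N△P)  ≡⟨ +-suc (size M) (size N△P) ⟩
    suc (size M) + size N△P  ≡⟨ cong (_+ size N△P) (size-M△P-endʳ last) ⟨
    size M△P + size N△P      ≡⟨ size-swapOn onWalk? M N ⟩
    size M + size N          ∎)
    where open ≡-Reasoning

  M△P≢M : ∀ {b} → N a₀ b ≡ true → ¬ SameSet M△P M
  M△P≢M {b} Na₀b same =
    not-¬ (trans (cong-app (swapOn-in onWalk? M N a₀-onWalk) b) Na₀b) (trans (same a₀ b) (a₀-free b))

  walk : Path E
  walk = record { m = steps ; v = orbit ∘ toℕ ; distinct = distinct ; step = step }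
    where
    distinct : Injective _≡_ _≡_ (orbit ∘ toℕ)
    distinct {i} {j} eq = toℕ-injective (orbit-injective (toℕ≤pred[n] i) (toℕ≤pred[n] j) eq)
    step : ∀ i → ∃[ a ] ∃[ b ]
             (Joins (orbit (toℕ (inject₁ i))) (orbit (suc (toℕ i))) a b × E a b ≡ true)
    step i = Step-edge (walk-step (toℕ<n i) (cong orbit (sym (toℕ-inject₁ i))) refl)

  onPath-intro : ∀ {i x y a b} → i < steps → orbit i ≡ x → orbit (suc i) ≡ y → Joins x y a b →
                 OnPath walk a b
  onPath-intro {i} {a = a} {b} i<steps refl refl J with fromℕ< i<steps | toℕ-fromℕ< i<steps
  ... | k | refl = k , subst (λ j → Joins (orbit j) (orbit (suc (toℕ k))) a b) (sym (toℕ-inject₁ k)) J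

  walk-edge : ∀ {a b} (k : Fin steps) → Joins (orbit (toℕ (inject₁ k))) (orbit (suc (toℕ k))) a b →
              M a b ≡ odd {nL} {nR} (toℕ k) × M a b xor N a b ≡ true
  walk-edge k J with toℕ (inject₁ k) | toℕ-inject₁ k
  ... | _ | refl =
    map₁ (λ M-side → trans M-side (walk-parity (<⇒≤ (toℕ<n k))))
         (alternating-edge (walk-step (toℕ<n k) refl refl) (orbit-no-backtrack (toℕ<n k) ∘ next-complete) J)

  walk-augmenting : ∀ {bE} → orbit steps ≡ inj₂ bE → Augmenting M walk
  walk-augmenting {bE} last = record
    { startFree = λ (b , Ma₀b) → not-¬ Ma₀b (a₀-free b)
    ; endFree   = subst (¬_ ∘ Matched M) (sym (trans (cong orbit (toℕ-fromℕ steps)) last)) bE-free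
    ; alternate = λ k _ _ J → proj₁ (walk-edge k J)
    }
    where
    bE-free : ¬ Matched M (inj₂ bE)
    bE-free (a , Mab) = walk-halts {y = inj₁ a} last Mab

  symDiff⇒onPath : SameSet N△P M → ∀ {a b} → symDiff M N a b ≡ true → OnPath walk a b
  symDiff⇒onPath N△P≡M {a} {b} d with onWalk? a
  ... | no ¬w = contradiction (trans (cong (M a b xor_) N≡M) (xor-same (M a b))) (not-¬ d)
    where
    N≡M : N a b ≡ M a b
    N≡M = trans (sym (cong-app (swapOn-out onWalk? N M ¬w) b)) (N△P≡M a b)
  ... | yes (i , s≤s i≤steps , eq) with N a b in Nab
  ...   | true with walk-succ {y = inj₂ b} i≤steps eq Nab
  ...     | i<steps , e = onPath-intro i<steps eq e (inj₁ (refl , refl))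
  symDiff⇒onPath N△P≡M {a} {b} d | yes (i , s≤s i≤steps , eq) | false
    with walk-pred {x = inj₂ b} i≤steps eq (trans (sym (xor-identityʳ (M a b))) d)
  ...     | j , refl , e = onPath-intro i≤steps e eq (inj₂ (refl , refl))

  symDiff⇔walk : SameSet N△P M → ∀ a b → (symDiff M N a b ≡ true) ⇔ OnPath walk a b
  symDiff⇔walk N△P≡M a b = mk⇔ (symDiff⇒onPath N△P≡M) λ (k , J) → proj₂ (walk-edge k J)

lemma4p3 : ∀ {nL nR : ℕ} (E : EdgeSet nL nR) (W : Weights nL nR) (k : ℕ)
             (Mk Mk1 : EdgeSubset nL nR)
           → Isolates E W k Mk
           → MinWeightMatching E W (suc k) Mk1
           → IsAugmentingPath E Mk (symDiff Mk Mk1)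
lemma4p3 E W k Mk Mk1 iso mw = walk , walk-augmenting (proj₂ ends-in-R) , symDiff⇔walk N△P≡Mk
  where
  module Mk  = Isolates iso
  module Mk1 = MinWeightMatching mw

  start : ∃ λ a → (∀ b → Mk a b ≡ false) × ∃ λ b → Mk1 a b ≡ true
  start = size<⇒free-vertex Mk.matching Mk1.matching (subst₂ _<_ (sym Mk.hasSize) (sym Mk1.hasSize) (n<1+n k))

  open AlternatingWalk Mk.matching Mk1.matching (proj₁ start) (proj₁ (proj₂ start))

  weights : weight W M△P +ℤ weight W N△P ≡ weight W Mk +ℤ weight W Mk1
  weights = weight-swapOn onWalk? W Mk Mk1

  ends-in-R : ∃ λ bE → orbit steps ≡ inj₂ bE
  ends-in-R with orbit steps in last
  ... | inj₂ bE = bE , refl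
  ... | inj₁ aE = contradiction
    (isolated-exchange iso mw M△P-isMatching N△P-isMatching
       (trans (size-M△P-endˡ last) Mk.hasSize) (trans (size-N△P-endˡ last) Mk1.hasSize) weights)
    (M△P≢M (proj₂ (proj₂ (proj₂ start))))

  N△P≡Mk : SameSet N△P Mk
  N△P≡Mk = isolated-exchange iso mw N△P-isMatching M△P-isMatching
    (ℕₚ.suc-injective (trans (size-N△P-endʳ (proj₂ ends-in-R)) Mk1.hasSize))
    (trans (size-M△P-endʳ (proj₂ ends-in-R)) (cong suc Mk.hasSize))
    (trans (ℤₚ.+-comm (weight W N△P) (weight W M△P)) weights)
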